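{- Let $\overline{D}\in\mathcal{D}_{\mathcal{K}}$ with $\operatorname{area}(\overline{D})>0$. Let $\mathbb{S}$ be the rightmost red arrow among those of largest starting rank, let $i=r(\mathbb{S})$ and $k=\ell(\mathbb{S})$, and let $\mathbb{W}$ be the blue arrow immediately following $\mathbb{S}$. Let $\overline{D}'$ be obtained by interchanging $\mathbb{S}$ and $\mathbb{W}$, and let $D=\Phi(\overline{D})$, $D'=\Phi(\overline{D}')$. Then $$\operatorname{area}(D)-\operatorname{area}(D')=\sum_{S\in S^{\mathcal{L}}_{\{i-1\}}}\ell(S)-k\,|S^{\mathcal{L}}_{\{i-1\}}|+|S^{\mathcal{L}}_{\{i\}}|-c^b(B_1)-c^b(B_2).$$
   Context: Paths. Let $\vec{k}=(k_1,\dots,k_n)$ be positive integers, $|\vec{k}|=\sum_ik_i$. A $\vec{k}$-Dyck path is a sequence $(a_1,\dots,a_{|\vec{k}|+n})$ obtained by interspersing $|\vec{k}|$ entries $-1$ among $k_1,\dots,k_n$ (in order) so that all partial sums $r_j=a_1+\cdots+a_{j-1}$ are $\ge0$; drawn as a lattice path with steps $(1,a_j)$. Entries $k_i$ are red arrows, entries $-1$ blue arrows. $\mathcal{D}_{\mathcal{K}}$ is the union of the sets of $\vec{k}'$-Dyck paths over all rearrangements $\vec{k}'$ of $\vec{k}$. For the $j$-th arrow $A$: $r(A)=r_j$, $\dot r(A)=r_{j+1}$ ($0$ for the last arrow), $\ell(A)=\dot r(A)-r(A)$. $A<B$ means $A$ is left of $B$; $A<^sB$ means $r(A)<r(B)$,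 or $r(A)=r(B)$ and $B<A$. The sweep map $\Phi(D)$ lists the arrows of $D$ in increasing $<^s$ order. $\operatorname{area}(D)=\sum_S r(S)$ over red arrows $S$. Notation. For $\mathbf{U}\subseteq\mathbb{N}$, $S^{\mathcal{L}}_{\mathbf{U}}$ is the set of red arrows $S$ of $\overline{D}$ with $S<\mathbb{S}$ and $r(S)\in\mathbf{U}$ (this is the same set of arrows in $\overline{D}'$, left of $\mathbb{S}'$). $c^b(B_1)$ denotes the number of blue arrows $W$ of $\overline{D}$ with $W<\mathbb{S}$ and $r(W)=i-1$; $c^b(B_2)$ denotes the number of blue arrows $W$ of $\overline{D}$ with $\mathbb{S}<W$ and $r(W)=i$. -}

module Defs where

open import Data.Bool using (Bool; true; false; _∧_; _∨_; if_then_else_)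
open import Data.Nat as ℕ using (ℕ; suc; zero)
open import Data.Integer as ℤ using (ℤ; +_; -[1+_]; _+_; _-_; _*_; _≤_; _<_)
import Data.Integer.Properties as ℤP
import Data.Nat.Properties as ℕP
open import Data.List using (List; []; _∷_; _++_; map; foldr; filterᵇ; length)
open import Data.List.Relation.Unary.All using (All)
open import Data.List.Relation.Binary.Permutation.Propositional using (_↭_)
open import Relation.Nullary.Decidable using (⌊_⌋)
open import Relation.Binary.PropositionalEquality using (_≡_)

data Arrow : Set where
  red  : ℕ → Arrow
  blue : Arrow

val : Arrow → ℤ
val (red k) = + k
val blue    = -[1+ 0 ]

isRed : Arrow → Bool
isRed (red _) = true
isRed blue    = false

isBlue : Arrow → Bool
isBlue (red _) = false
isBlue blue    = true

redVals : List Arrow → List ℕ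
redVals []            = []
redVals (red k ∷ as)  = k ∷ redVals as
redVals (blue ∷ as)   = redVals as

countBlue : List Arrow → ℕ
countBlue as = length (filterᵇ isBlue as)

sumℕ : List ℕ → ℕ
sumℕ = foldr ℕ._+_ 0

sumℤ : List ℤ → ℤ
sumℤ = foldr _+_ (+ 0)

-- Data attached to the j-th arrow A of a path:
--   pos = j - 1 (0-based position), rk = r(A), len = ℓ(A) = ṙ(A) - r(A), arr = A.
record Info : Set where
  constructor info
  field
    pos : ℕ
    rk  : ℤ
    len : ℤ
    arr : Arrow
open Info public

-- annot r p as : annotate the arrows as, the first having rank r and position p.
-- ṙ(A) is the rank of the next arrow, and 0 for the last arrow.
annot : ℤ → ℕ → List Arrow → List Info
annot r p []            = []
annot r p (a ∷ [])      = info p r (+ 0 - r) a ∷ []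
annot r p (a ∷ b ∷ as)  = info p r ((r + val a) - r) a ∷ annot (r + val a) (suc p) (b ∷ as)

infos : List Arrow → List Info
infos = annot (+ 0) 0

-- k⃗-Dyck path condition for some rearrangement of ks: D ∈ 𝒟_𝒦 with 𝒦 given by ks.
record InDK (ks : List ℕ) (D : List Arrow) : Set where
  field
    ks-pos    : All (λ k → 0 ℕ.< k) ks
    reds-perm : redVals D ↭ ks
    blues     : countBlue D ≡ sumℕ ks
    ranks-nonneg : All (λ x → + 0 ≤ rk x) (infos D)

area : List Arrow → ℤ
area D = sumℤ (map rk (filterᵇ (λ x → isRed (arr x)) (infos D)))

_<ˢᵇ_ : Info → Info → Bool
x <ˢᵇ y = ⌊ rk x ℤ.<? rk y ⌋ ∨ (⌊ rk x ℤ.≟ rk y ⌋ ∧ ⌊ pos y ℕ.<? pos x ⌋)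

insertˢ : Info → List Info → List Info
insertˢ x []       = x ∷ []
insertˢ x (y ∷ ys) = if x <ˢᵇ y then x ∷ y ∷ ys else y ∷ insertˢ x ys

sortˢ : List Info → List Info
sortˢ = foldr insertˢ []

Φ : List Arrow → List Arrow
Φ D = map arr (sortˢ (infos D))

SL : ℤ → ℕ → List Arrow → List Info
SL u p D = filterᵇ (λ x → isRed (arr x) ∧ ⌊ pos x ℕ.<? p ⌋ ∧ ⌊ rk x ℤ.≟ u ⌋) (infos D)

cbLeft : ℤ → ℕ → List Arrow → ℕ
cbLeft u p D = length (filterᵇ (λ x → isBlue (arr x) ∧ ⌊ pos x ℕ.<? p ⌋ ∧ ⌊ rk x ℤ.≟ u ⌋) (infos D))

cbRight : ℤ → ℕ → List Arrow → ℕ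
cbRight u p D = length (filterᵇ (λ x → isBlue (arr x) ∧ ⌊ p ℕ.<? pos x ⌋ ∧ ⌊ rk x ℤ.≟ u ⌋) (infos D))

module Submission where

-- A red arrow's rank in Φ D is the total value of the arrows preceding it in the sweep order,
-- and that order is read off the ranks and positions in D.  Hence area (Φ D) is a sum of terms
-- over pairs of arrows of D (sweepArea).  Passing from D̄ to D̄′ moves only 𝕊 and 𝕎; every other
-- arrow x keeps its rank and position, so area (Φ D̄) - area (Φ D̄′) is the sum over these x of the
-- change δ x of their pair terms with 𝕊 and 𝕎.  Splitting according to r(x) < i - 1, = i - 1,
-- = i or > i, and to x lying left or right of 𝕊, each δ x equals the contribution ρ x of x to
-- the right-hand side, i.e. its membership in S^𝓛_{i-1}, S^𝓛_{i}, B₁ or B₂.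

open import Defs
open import Data.Bool using (Bool; true; false; T; _∧_; if_then_else_)
open import Data.Bool.Properties using (∧-identityʳ; ∧-zeroʳ)
open import Data.Empty using (⊥-elim)
open import Data.Unit using (tt)
open import Data.Integer as ℤ using (ℤ; +_; -[1+_]; _+_; _-_; _*_; _≤_; _<_)
import Data.Integer.Properties as ℤP
open import Data.Integer.Tactic.RingSolver using (solve-∀)
open import Algebra.Properties.CommutativeSemigroup ℤP.+-commutativeSemigroup
  using () renaming (interchange to +-interchange; x∙yz≈y∙xz to +-swapˡ; xy∙z≈xz∙y to +-swapʳ)
open import Data.List using (List; []; _∷_; _++_; length; map; filterᵇ)
open import Data.List.Properties using (map-cong)
open import Data.List.Relation.Unary.All as All using (All; []; _∷_)
open import Data.List.Relation.Unary.All.Properties using (++⁻)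
open import Data.List.Relation.Binary.Permutation.Propositional using (↭-sym)
open import Data.List.Relation.Binary.Permutation.Propositional.Properties using (All-resp-↭)
open import Data.List.Relation.Unary.AllPairs using (AllPairs; []; _∷_)
open import Data.Nat using (ℕ; zero; suc)
import Data.Nat as ℕ
import Data.Nat.Properties as ℕP
open import Data.Product using (∃; ∃₂; _×_; _,_; proj₁; proj₂)
open import Data.Product.Relation.Binary.Lex.Strict
  using (×-Lex; ×-decidable; ×-transitive; ×-asymmetric; ×-compare)
open import Data.Sum using (_⊎_; inj₁; inj₂)
open import Function using (_on_; flip; _∘_)
open import Relation.Binary.Definitions using (Decidable; tri<; tri≈; tri>)
open import Relation.Binary.PropositionalEquality
open import Relation.Nullary using (¬_; Dec; yes; no)
open import Relation.Nullary.Decidable using (⌊_⌋; isYes≗does; dec-true; dec-false)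

⌊⌋-true : ∀ {A : Set} (a? : Dec A) → A → ⌊ a? ⌋ ≡ true
⌊⌋-true a? a = trans (isYes≗does a?) (dec-true a? a)

⌊⌋-false : ∀ {A : Set} (a? : Dec A) → ¬ A → ⌊ a? ⌋ ≡ false
⌊⌋-false a? ¬a = trans (isYes≗does a?) (dec-false a? ¬a)

∑ : ∀ {A : Set} → (A → ℤ) → List A → ℤ
∑ f xs = sumℤ (map f xs)

∑-++ : ∀ {A : Set} (f : A → ℤ) xs ys → ∑ f (xs ++ ys) ≡ ∑ f xs + ∑ f ys
∑-++ f []       ys = sym (ℤP.+-identityˡ _)
∑-++ f (x ∷ xs) ys = trans (cong (_+_ (f x)) (∑-++ f xs ys)) (sym (ℤP.+-assoc (f x) _ _))

∑-cong : ∀ {A : Set} {P : A → Set} {f g : A → ℤ} {xs} →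
         (∀ {x} → P x → f x ≡ g x) → All P xs → ∑ f xs ≡ ∑ g xs
∑-cong f≡g []         = refl
∑-cong f≡g (px ∷ pxs) = cong₂ _+_ (f≡g px) (∑-cong f≡g pxs)

∑-+ : ∀ {A : Set} (f g : A → ℤ) xs → ∑ (λ x → f x + g x) xs ≡ ∑ f xs + ∑ g xs
∑-+ f g []       = refl
∑-+ f g (x ∷ xs) = trans (cong (_+_ (f x + g x)) (∑-+ f g xs)) (+-interchange (f x) (g x) _ _)

∑-- : ∀ {A : Set} (f g : A → ℤ) xs → ∑ (λ x → f x - g x) xs ≡ ∑ f xs - ∑ g xs
∑-- f g []       = refl
∑-- f g (x ∷ xs) = begin
  f x - g x + ∑ (λ x → f x - g x) xs   ≡⟨ cong (_+_ (f x - g x)) (∑-- f g xs) ⟩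
  f x - g x + (∑ f xs - ∑ g xs)        ≡⟨ +-interchange (f x) (ℤ.- g x) (∑ f xs) (ℤ.- ∑ g xs) ⟩
  f x + ∑ f xs + (ℤ.- g x ℤ.- ∑ g xs)  ≡⟨ cong (_+_ (f x + ∑ f xs)) (sym (ℤP.neg-distrib-+ (g x) (∑ g xs))) ⟩
  f x + ∑ f xs - (g x + ∑ g xs)        ∎
  where open ≡-Reasoning

χ : Bool → ℤ
χ b = if b then + 1 else + 0

∑-filterᵇ : ∀ {A : Set} (f : A → ℤ) (P : A → Bool) xs →
            ∑ f (filterᵇ P xs) ≡ ∑ (λ x → if P x then f x else + 0) xs
∑-filterᵇ f P []       = refl
∑-filterᵇ f P (x ∷ xs) with P x
... | true  = cong (_+_ (f x)) (∑-filterᵇ f P xs)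
... | false = trans (∑-filterᵇ f P xs) (sym (ℤP.+-identityˡ _))

length-filterᵇ : ∀ {A : Set} (P : A → Bool) xs → + length (filterᵇ P xs) ≡ ∑ (λ x → χ (P x)) xs
length-filterᵇ P []       = refl
length-filterᵇ P (x ∷ xs) with P x
... | true  = cong (_+_ (+ 1)) (length-filterᵇ P xs)
... | false = trans (length-filterᵇ P xs) (sym (ℤP.+-identityˡ _))

_<ˢ_ : Info → Info → Set
_<ˢ_ = ×-Lex _≡_ _<_ ℕ._>_ on λ x → rk x , pos x

_<ˢ?_ : Decidable _<ˢ_
x <ˢ? y = ×-decidable ℤ._≟_ ℤ._<?_ (flip ℕ._<?_) (rk x , pos x) (rk y , pos y)

<ˢᵇ≡⌊<ˢ?⌋ : ∀ x y → (x <ˢᵇ y) ≡ ⌊ x <ˢ? y ⌋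
<ˢᵇ≡⌊<ˢ?⌋ x y
  rewrite isYes≗does (rk x ℤ.<? rk y) | isYes≗does (rk x ℤ.≟ rk y) | isYes≗does (pos y ℕ.<? pos x)
  = sym (isYes≗does (x <ˢ? y))

<ˢᵇ-true : ∀ {x y} → x <ˢ y → (x <ˢᵇ y) ≡ true
<ˢᵇ-true {x} {y} x<y = trans (<ˢᵇ≡⌊<ˢ?⌋ x y) (⌊⌋-true (x <ˢ? y) x<y)

<ˢᵇ-false : ∀ {x y} → ¬ x <ˢ y → (x <ˢᵇ y) ≡ false
<ˢᵇ-false {x} {y} x≮y = trans (<ˢᵇ≡⌊<ˢ?⌋ x y) (⌊⌋-false (x <ˢ? y) x≮y)

<ˢ-trans : ∀ {x y z} → x <ˢ y → y <ˢ z → x <ˢ z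
<ˢ-trans {x} {y} {z} = ×-transitive {_≈₁_ = _≡_} {_<₁_ = _<_} {_<₂_ = ℕ._>_}
  isEquivalence (resp₂ _<_) ℤP.<-trans (flip ℕP.<-trans) {rk x , pos x} {rk y , pos y} {rk z , pos z}

<ˢ-asym : ∀ {x y} → x <ˢ y → ¬ y <ˢ x
<ˢ-asym {x} {y} = ×-asymmetric {_≈₁_ = _≡_} {_<₁_ = _<_} {_<₂_ = ℕ._>_}
  sym (resp₂ _<_) ℤP.<-asym ℕP.<-asym {rk x , pos x} {rk y , pos y}

<ˢ-connex : ∀ x y → pos x ≢ pos y → x <ˢ y ⊎ y <ˢ x
<ˢ-connex x y px≢py with ×-compare sym ℤP.<-cmp (flip ℕP.<-cmp) (rk x , pos x) (rk y , pos y)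
... | tri< x<y _ _          = inj₁ x<y
... | tri≈ _ (_ , py≡px) _ = ⊥-elim (px≢py (sym py≡px))
... | tri> _ _ y<x          = inj₂ y<x

insertˢ-< : ∀ {x y ys} → x <ˢ y → insertˢ x (y ∷ ys) ≡ x ∷ y ∷ ys
insertˢ-< {x} {y} x<y rewrite <ˢᵇ-true {x} {y} x<y = refl

insertˢ-≮ : ∀ {x y ys} → ¬ x <ˢ y → insertˢ x (y ∷ ys) ≡ y ∷ insertˢ x ys
insertˢ-≮ {x} {y} x≮y rewrite <ˢᵇ-false {x} {y} x≮y = refl

Sortedˢ : List Info → Set
Sortedˢ = AllPairs _<ˢ_

insertˢ-All : ∀ {P : Info → Set} {x} ys → P x → All P ys → All P (insertˢ x ys)
insertˢ-All         []       px []         = px ∷ []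
insertˢ-All {x = x} (y ∷ ys) px (py ∷ pys) with x <ˢᵇ y
... | true  = px ∷ py ∷ pys
... | false = py ∷ insertˢ-All ys px pys

sortˢ-All : ∀ {P : Info → Set} xs → All P xs → All P (sortˢ xs)
sortˢ-All []       []         = []
sortˢ-All (x ∷ xs) (px ∷ pxs) = insertˢ-All (sortˢ xs) px (sortˢ-All xs pxs)

insertˢ-sorted : ∀ x ys → All (λ y → pos x ≢ pos y) ys → Sortedˢ ys → Sortedˢ (insertˢ x ys)
insertˢ-sorted x []       []          []              = [] ∷ []
insertˢ-sorted x (y ∷ ys) (x≢y ∷ x≢ys) (y<ys ∷ sorted) with x <ˢ? y
... | yes x<y rewrite insertˢ-< {x} {y} {ys} x<y =
  (x<y ∷ All.map (λ {z} → <ˢ-trans {x} {y} {z} x<y) y<ys) ∷ y<ys ∷ sorted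
... | no x≮y rewrite insertˢ-≮ {x} {y} {ys} x≮y =
  insertˢ-All {P = _<ˢ_ y} ys y<x y<ys ∷ insertˢ-sorted x ys x≢ys sorted
  where
  y<x : y <ˢ x
  y<x with <ˢ-connex x y x≢y
  ... | inj₁ x<y = ⊥-elim (x≮y x<y)
  ... | inj₂ y<x = y<x

sortˢ-sorted : ∀ xs → AllPairs (λ x y → pos x ≢ pos y) xs → Sortedˢ (sortˢ xs)
sortˢ-sorted []       []            = []
sortˢ-sorted (x ∷ xs) (x≢xs ∷ dist) =
  insertˢ-sorted x (sortˢ xs) (sortˢ-All xs x≢xs) (sortˢ-sorted xs dist)

∑-insertˢ : ∀ (f : Info → ℤ) x ys → ∑ f (insertˢ x ys) ≡ f x + ∑ f ys
∑-insertˢ f x []       = refl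
∑-insertˢ f x (y ∷ ys) with x <ˢᵇ y
... | true  = refl
... | false = trans (cong (_+_ (f y)) (∑-insertˢ f x ys)) (+-swapˡ (f y) (f x) _)

∑-sortˢ : ∀ (f : Info → ℤ) xs → ∑ f (sortˢ xs) ≡ ∑ f xs
∑-sortˢ f []       = refl
∑-sortˢ f (x ∷ xs) = trans (∑-insertˢ f x (sortˢ xs)) (cong (_+_ (f x)) (∑-sortˢ f xs))

annot-pos-≥ : ∀ r p as → All (λ x → p ℕ.≤ pos x) (annot r p as)
annot-pos-≥ r p []           = []
annot-pos-≥ r p (a ∷ [])     = ℕP.≤-refl ∷ []
annot-pos-≥ r p (a ∷ b ∷ as) = ℕP.≤-refl ∷ All.map ℕP.<⇒≤ (annot-pos-≥ (r + val a) (suc p) (b ∷ as))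

annot-pos-distinct : ∀ r p as → AllPairs (λ x y → pos x ≢ pos y) (annot r p as)
annot-pos-distinct r p []           = []
annot-pos-distinct r p (a ∷ [])     = [] ∷ []
annot-pos-distinct r p (a ∷ b ∷ as) =
  All.map ℕP.<⇒≢ (annot-pos-≥ (r + val a) (suc p) (b ∷ as))
  ∷ annot-pos-distinct (r + val a) (suc p) (b ∷ as)

-- gain x y is what x contributes to the rank of the red arrow y once the arrows are swept.
gain : Info → Info → ℤ
gain x y = if isRed (arr y) ∧ (x <ˢᵇ y) then val (arr x) else + 0

pair : Info → Info → ℤ
pair x y = gain x y + gain y x

pairs : Info → List Info → ℤ
pairs x = ∑ (pair x)

sweepArea : List Info → ℤ
sweepArea []       = + 0
sweepArea (x ∷ xs) = pairs x xs + sweepArea xs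

pair-comm : ∀ x y → pair x y ≡ pair y x
pair-comm x y = ℤP.+-comm (gain x y) (gain y x)

pair-< : ∀ x y → x <ˢ y → pair x y ≡ (if isRed (arr y) then val (arr x) else + 0)
pair-< x y x<y
  rewrite <ˢᵇ-true {x} {y} x<y | <ˢᵇ-false {y} {x} (<ˢ-asym {x} {y} x<y)
        | ∧-identityʳ (isRed (arr y)) | ∧-zeroʳ (isRed (arr x))
  = ℤP.+-identityʳ _

pair-> : ∀ x y → y <ˢ x → pair x y ≡ (if isRed (arr x) then val (arr y) else + 0)
pair-> x y y<x = trans (pair-comm x y) (pair-< y x y<x)

redCount : List Arrow → ℤ
redCount []           = + 0
redCount (red _ ∷ as) = + 1 + redCount as
redCount (blue ∷ as)  = redCount as

-- Every red arrow's rank is the sum of the values of the arrows before it.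
areaByPairs : List Arrow → ℤ
areaByPairs []       = + 0
areaByPairs (a ∷ as) = val a * redCount as + areaByPairs as

redRankSum : List Info → ℤ
redRankSum xs = sumℤ (map rk (filterᵇ (λ x → isRed (arr x)) xs))

redRankSum-annot : ∀ r p as → redRankSum (annot r p as) ≡ r * redCount as + areaByPairs as
redRankSum-annot r p []               = solve r
  where solve : ∀ r → + 0 ≡ r * + 0 + + 0
        solve = solve-∀
redRankSum-annot r p (red k ∷ [])     = solve r (+ k)
  where solve : ∀ r k → r + + 0 ≡ r * (+ 1 + + 0) + (k * + 0 + + 0)
        solve = solve-∀
redRankSum-annot r p (blue ∷ [])      = solve r
  where solve : ∀ r → + 0 ≡ r * + 0 + (-[1+ 0 ] * + 0 + + 0)
        solve = solve-∀
redRankSum-annot r p (red k ∷ b ∷ as) =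
  trans (cong (_+_ r) (redRankSum-annot (r + + k) (suc p) (b ∷ as))) (solve r (+ k) _ _)
  where solve : ∀ r k n g → r + ((r + k) * n + g) ≡ r * (+ 1 + n) + (k * n + g)
        solve = solve-∀
redRankSum-annot r p (blue ∷ b ∷ as)  =
  trans (redRankSum-annot (r + -[1+ 0 ]) (suc p) (b ∷ as)) (solve r _ _)
  where solve : ∀ r n g → (r + -[1+ 0 ]) * n + g ≡ r * n + (-[1+ 0 ] * n + g)
        solve = solve-∀

pairs-below : ∀ x ys → All (λ y → x <ˢ y) ys → pairs x ys ≡ val (arr x) * redCount (map arr ys)
pairs-below x []       []           = sym (ℤP.*-zeroʳ (val (arr x)))
pairs-below x (y ∷ ys) (x<y ∷ x<ys) rewrite pair-< x y x<y | pairs-below x ys x<ys with arr y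
... | red _ = solve (val (arr x)) _
  where solve : ∀ v n → v + v * n ≡ v * (+ 1 + n)
        solve = solve-∀
... | blue  = ℤP.+-identityˡ _

areaByPairs-sorted : ∀ xs → Sortedˢ xs → areaByPairs (map arr xs) ≡ sweepArea xs
areaByPairs-sorted []       []             = refl
areaByPairs-sorted (x ∷ xs) (x<xs ∷ sorted) =
  cong₂ _+_ (sym (pairs-below x xs x<xs)) (areaByPairs-sorted xs sorted)

sweepArea-insertˢ : ∀ x ys → sweepArea (insertˢ x ys) ≡ sweepArea (x ∷ ys)
sweepArea-insertˢ x []       = refl
sweepArea-insertˢ x (y ∷ ys) with x <ˢ? y
... | yes x<y rewrite insertˢ-< {x} {y} {ys} x<y = refl
... | no x≮y rewrite insertˢ-≮ {x} {y} {ys} x≮y = begin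
  pairs y (insertˢ x ys) + sweepArea (insertˢ x ys)
    ≡⟨ cong₂ _+_ (∑-insertˢ (pair y) x ys) (sweepArea-insertˢ x ys) ⟩
  pair y x + pairs y ys + (pairs x ys + sweepArea ys)
    ≡⟨ cong (λ t → t + pairs y ys + (pairs x ys + sweepArea ys)) (pair-comm y x) ⟩
  pair x y + pairs y ys + (pairs x ys + sweepArea ys)
    ≡⟨ +-interchange (pair x y) (pairs y ys) (pairs x ys) (sweepArea ys) ⟩
  pair x y + pairs x ys + (pairs y ys + sweepArea ys) ∎
  where open ≡-Reasoning

sweepArea-sortˢ : ∀ xs → sweepArea (sortˢ xs) ≡ sweepArea xs
sweepArea-sortˢ []       = refl
sweepArea-sortˢ (x ∷ xs) = trans (sweepArea-insertˢ x (sortˢ xs))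
  (cong₂ _+_ (∑-sortˢ (pair x) xs) (sweepArea-sortˢ xs))

area-Φ : ∀ D → area (Φ D) ≡ sweepArea (infos D)
area-Φ D = begin
  area (Φ D)
    ≡⟨ redRankSum-annot (+ 0) 0 swept ⟩
  + 0 * redCount swept + areaByPairs swept
    ≡⟨ ℤP.+-identityˡ _ ⟩
  areaByPairs swept
    ≡⟨ areaByPairs-sorted _ (sortˢ-sorted _ (annot-pos-distinct (+ 0) 0 D)) ⟩
  sweepArea (sortˢ (infos D))
    ≡⟨ sweepArea-sortˢ (infos D) ⟩
  sweepArea (infos D) ∎
  where
  open ≡-Reasoning
  swept = map arr (sortˢ (infos D))

pairsBetween : List Info → List Info → ℤ
pairsBetween xs ys = ∑ (λ x → pairs x ys) xs

pairsBetween-[]ʳ : ∀ xs → pairsBetween xs [] ≡ + 0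
pairsBetween-[]ʳ []       = refl
pairsBetween-[]ʳ (x ∷ xs) = trans (ℤP.+-identityˡ _) (pairsBetween-[]ʳ xs)

pairsBetween-comm : ∀ xs ys → pairsBetween xs ys ≡ pairsBetween ys xs
pairsBetween-comm []       ys = sym (pairsBetween-[]ʳ ys)
pairsBetween-comm (x ∷ xs) ys = begin
  pairs x ys + pairsBetween xs ys
    ≡⟨ cong₂ _+_ (cong sumℤ (map-cong (pair-comm x) ys)) (pairsBetween-comm xs ys) ⟩
  ∑ (λ y → pair y x) ys + pairsBetween ys xs
    ≡⟨ sym (∑-+ (λ y → pair y x) (λ y → pairs y xs) ys) ⟩
  pairsBetween ys (x ∷ xs) ∎
  where open ≡-Reasoning

sweepArea-++ : ∀ xs ys → sweepArea (xs ++ ys) ≡ sweepArea xs + sweepArea ys + pairsBetween xs ys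
sweepArea-++ []       ys = sym (trans (ℤP.+-identityʳ _) (ℤP.+-identityˡ _))
sweepArea-++ (x ∷ xs) ys = begin
  pairs x (xs ++ ys) + sweepArea (xs ++ ys)
    ≡⟨ cong₂ _+_ (∑-++ (pair x) xs ys) (sweepArea-++ xs ys) ⟩
  pairs x xs + pairs x ys + (sweepArea xs + sweepArea ys + pairsBetween xs ys)
    ≡⟨ solve (pairs x xs) (pairs x ys) (sweepArea xs) (sweepArea ys) (pairsBetween xs ys) ⟩
  pairs x xs + sweepArea xs + sweepArea ys + (pairs x ys + pairsBetween xs ys) ∎
  where
  open ≡-Reasoning
  solve : ∀ a b c d e → a + b + (c + d + e) ≡ a + c + d + (b + e)
  solve = solve-∀

pairsBetween-++ʳ : ∀ xs ys zs → pairsBetween xs (ys ++ zs) ≡ pairsBetween xs ys + pairsBetween xs zs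
pairsBetween-++ʳ xs ys zs =
  trans (cong sumℤ (map-cong (λ x → ∑-++ (pair x) ys zs) xs)) (∑-+ (λ x → pairs x ys) (λ x → pairs x zs) xs)

sweepArea-replace : ∀ A M M′ C →
  sweepArea (A ++ M ++ C) - sweepArea (A ++ M′ ++ C)
    ≡ sweepArea M - sweepArea M′ + (∑ (λ x → pairs x M - pairs x M′) A + ∑ (λ x → pairs x M - pairs x M′) C)
sweepArea-replace A M M′ C = begin
  sweepArea (A ++ M ++ C) - sweepArea (A ++ M′ ++ C)
    ≡⟨ cong₂ _-_ (split M) (split M′) ⟩
  sweepArea A + (sweepArea M + sweepArea C + pairsBetween C M) + (pairsBetween A M + pairsBetween A C)
    - (sweepArea A + (sweepArea M′ + sweepArea C + pairsBetween C M′) + (pairsBetween A M′ + pairsBetween A C))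
    ≡⟨ solve (sweepArea A) (sweepArea M) (sweepArea M′) (sweepArea C) (pairsBetween C M) (pairsBetween C M′)
             (pairsBetween A M) (pairsBetween A M′) (pairsBetween A C) ⟩
  sweepArea M - sweepArea M′ + ((pairsBetween A M - pairsBetween A M′) + (pairsBetween C M - pairsBetween C M′))
    ≡⟨ cong (_+_ (sweepArea M - sweepArea M′))
         (sym (cong₂ _+_ (∑-- (λ x → pairs x M) (λ x → pairs x M′) A)
                         (∑-- (λ x → pairs x M) (λ x → pairs x M′) C))) ⟩
  sweepArea M - sweepArea M′ + (∑ (λ x → pairs x M - pairs x M′) A + ∑ (λ x → pairs x M - pairs x M′) C) ∎
  where
  open ≡-Reasoning
  split : ∀ N → sweepArea (A ++ N ++ C)
              ≡ sweepArea A + (sweepArea N + sweepArea C + pairsBetween C N) + (pairsBetween A N + pairsBetween A C)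
  split N = trans (sweepArea-++ A (N ++ C))
    (cong₂ (λ s t → sweepArea A + s + t)
      (trans (sweepArea-++ N C) (cong (_+_ (sweepArea N + sweepArea C)) (pairsBetween-comm N C)))
      (pairsBetween-++ʳ A N C))
  solve : ∀ a m m′ c n n′ e e′ f →
          a + (m + c + n) + (e + f) - (a + (m′ + c + n′) + (e′ + f)) ≡ m - m′ + ((e - e′) + (n - n′))
  solve = solve-∀

prefixInfos : ℤ → ℕ → List Arrow → List Info
prefixInfos r p []       = []
prefixInfos r p (a ∷ as) = info p r ((r + val a) - r) a ∷ prefixInfos (r + val a) (suc p) as

annot-∷ : ∀ r p a as → ∃ λ ℓ → annot r p (a ∷ as) ≡ info p r ℓ a ∷ annot (r + val a) (suc p) as
annot-∷ r p a []       = _ , refl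
annot-∷ r p a (_ ∷ _)  = _ , refl

annot-∷-++ : ∀ r p a as b bs →
  annot r p (a ∷ as ++ b ∷ bs) ≡ info p r ((r + val a) - r) a ∷ annot (r + val a) (suc p) (as ++ b ∷ bs)
annot-∷-++ r p a []      b bs = refl
annot-∷-++ r p a (_ ∷ _) b bs = refl

annot-++ : ∀ r p as b bs →
  annot r p (as ++ b ∷ bs) ≡ prefixInfos r p as ++ annot (r + sumℤ (map val as)) (p ℕ.+ length as) (b ∷ bs)
annot-++ r p []       b bs =
  cong₂ (λ r′ p′ → annot r′ p′ (b ∷ bs)) (sym (ℤP.+-identityʳ r)) (sym (ℕP.+-identityʳ p))
annot-++ r p (a ∷ as) b bs = trans (annot-∷-++ r p a as b bs) (cong (info p r ((r + val a) - r) a ∷_)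
  (trans (annot-++ (r + val a) (suc p) as b bs)
         (cong₂ (λ r′ p′ → prefixInfos (r + val a) (suc p) as ++ annot r′ p′ (b ∷ bs))
                (ℤP.+-assoc r (val a) _) (sym (ℕP.+-suc p (length as))))))

infos-split : ∀ L a b R → let i = sumℤ (map val L); p = length L in
  ∃₂ λ ℓa ℓb → infos (L ++ a ∷ b ∷ R)
    ≡ prefixInfos (+ 0) 0 L ++ info p i ℓa a ∷ info (suc p) (i + val a) ℓb b ∷ annot (i + val a + val b) (suc (suc p)) R
infos-split L a b R with annot-∷ (sumℤ (map val L) + val a) (suc (length L)) b R
... | ℓb , annot≡ = _ , ℓb , (begin
  annot (+ 0) 0 (L ++ a ∷ b ∷ R)
    ≡⟨ annot-++ (+ 0) 0 L a (b ∷ R) ⟩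
  prefixInfos (+ 0) 0 L ++ annot (+ 0 + sumℤ (map val L)) (length L) (a ∷ b ∷ R)
    ≡⟨ cong (λ r → prefixInfos (+ 0) 0 L ++ annot r (length L) (a ∷ b ∷ R)) (ℤP.+-identityˡ _) ⟩
  prefixInfos (+ 0) 0 L ++ annot (sumℤ (map val L)) (length L) (a ∷ b ∷ R)
    ≡⟨ cong (λ t → prefixInfos (+ 0) 0 L ++ info (length L) _ _ a ∷ t) annot≡ ⟩
  _ ∎)
  where open ≡-Reasoning

prefixInfos-pos : ∀ r p as → All (λ x → pos x ℕ.< p ℕ.+ length as) (prefixInfos r p as)
prefixInfos-pos r p []       = []
prefixInfos-pos r p (a ∷ as) rewrite ℕP.+-suc p (length as) =
  ℕ.s≤s (ℕP.m≤m+n p (length as)) ∷ prefixInfos-pos (r + val a) (suc p) as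

prefixInfos-len : ∀ r p as → All (λ x → len x ≡ val (arr x)) (prefixInfos r p as)
prefixInfos-len r p []       = []
prefixInfos-len r p (a ∷ as) = solve r (val a) ∷ prefixInfos-len (r + val a) (suc p) as
  where solve : ∀ r v → (r + v) - r ≡ v
        solve = solve-∀

RedMaximal LeftOfSwap RightOfSwap : ℤ → ℕ → Info → Set
RedMaximal  i p x = T (isRed (arr x)) → (rk x ≤ i) × (rk x ≡ i → pos x ℕ.≤ p)
LeftOfSwap  i p x = pos x ℕ.< p × len x ≡ val (arr x) × (T (isRed (arr x)) → rk x ≤ i)
RightOfSwap i p x = suc p ℕ.< pos x × (T (isRed (arr x)) → rk x < i)

prefixInfos-leftOfSwap : ∀ {i} L → All (RedMaximal i (length L)) (prefixInfos (+ 0) 0 L) →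
                         All (LeftOfSwap i (length L)) (prefixInfos (+ 0) 0 L)
prefixInfos-leftOfSwap L maximal = All.zipWith
  (λ { ((q<p , ℓ≡v) , max) → q<p , ℓ≡v , proj₁ ∘ max })
  (All.zip (prefixInfos-pos (+ 0) 0 L , prefixInfos-len (+ 0) 0 L) , maximal)

annot-rightOfSwap : ∀ {i p} r R → All (RedMaximal i p) (annot r (suc (suc p)) R) →
                    All (RightOfSwap i p) (annot r (suc (suc p)) R)
annot-rightOfSwap {p = p} r R maximal = All.zipWith
  (λ { (p+1<q , max) → p+1<q , λ red →
       ℤP.≤∧≢⇒< (proj₁ (max red)) (λ r≡i → ℕP.<⇒≱ (ℕP.<⇒≤ p+1<q) (proj₂ (max red) r≡i)) })
  (annot-pos-≥ r (suc (suc p)) R , maximal)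

i-1<i : ∀ i → i - + 1 < i
i-1<i i = subst (i - + 1 <_) (ℤP.+-identityʳ i) (ℤP.+-monoʳ-< i ℤ.-<+)

i<i+1+k : ∀ i k → i < i + + suc k
i<i+1+k i k = subst (_< i + + suc k) (ℤP.+-identityʳ i) (ℤP.+-monoʳ-< i (ℤ.+<+ (ℕ.s≤s ℕ.z≤n)))

data RankClass (i : ℤ) : ℤ → Set where
  below     : ∀ {r} → r < i - + 1 → RankClass i r
  justBelow : RankClass i (i - + 1)
  level     : RankClass i i
  above     : ∀ {r} → i < r → RankClass i r

rankClass : ∀ i r → RankClass i r
rankClass i r with ℤP.<-cmp r (i - + 1)
... | tri< r<i-1 _ _ = below r<i-1
... | tri≈ _ refl _  = justBelow
... | tri> _ _ i-1<r with ℤP.<-cmp i r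
...   | tri< i<r _ _ = above i<r
...   | tri≈ _ refl _ = level
...   | tri> _ _ r<i = ⊥-elim (ℤP.<⇒≱ r<i (subst (_≤ r) (suc[i-1]≡i i) (ℤP.i<j⇒suc[i]≤j i-1<r)))
  where
  suc[i-1]≡i : ∀ j → + 1 + (j - + 1) ≡ j
  suc[i-1]≡i = solve-∀

module Swap (i : ℤ) (p k₀ : ℕ) (ℓS ℓW ℓW′ ℓS′ : ℤ) where

  k : ℕ
  k = suc k₀

  S W W′ S′ : Info
  S  = info p       i         ℓS  (red k)
  W  = info (suc p) (i + + k) ℓW  blue
  W′ = info p       i         ℓW′ blue
  S′ = info (suc p) (i - + 1) ℓS′ (red k)

  δ : Info → ℤ
  δ x = pairs x (S ∷ W ∷ []) - pairs x (W′ ∷ S′ ∷ [])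

  inSL₋ inSL inB₁ inB₂ : Info → Bool
  inSL₋ x = isRed (arr x) ∧ ⌊ pos x ℕ.<? p ⌋ ∧ ⌊ rk x ℤ.≟ (i - + 1) ⌋
  inSL  x = isRed (arr x) ∧ ⌊ pos x ℕ.<? p ⌋ ∧ ⌊ rk x ℤ.≟ i ⌋
  inB₁  x = isBlue (arr x) ∧ ⌊ pos x ℕ.<? p ⌋ ∧ ⌊ rk x ℤ.≟ (i - + 1) ⌋
  inB₂  x = isBlue (arr x) ∧ ⌊ p ℕ.<? pos x ⌋ ∧ ⌊ rk x ℤ.≟ i ⌋

  lenSL₋ : Info → ℤ
  lenSL₋ x = if inSL₋ x then len x else + 0

  ρ : Info → ℤ
  ρ x = lenSL₋ x - χ (inSL₋ x) * + k + χ (inSL x) - χ (inB₁ x) - χ (inB₂ x)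

  i<i+k : i < i + + k
  i<i+k = i<i+1+k i k₀

  i-1<i+k : i - + 1 < i + + k
  i-1<i+k = ℤP.<-trans (i-1<i i) i<i+k

  -- Once the pair terms are evaluated, those of a blue arrow are closed terms; only red
  -- arrows leave some arithmetic.
  private
    cancel : ∀ v → v + + 0 - (+ 0 + (v + + 0)) ≡ + 0
    cancel = solve-∀
    justBelow-red : ∀ v k → v + + 0 - (+ 0 + (k + + 0)) ≡ v - + 1 * k + + 0 - + 0 - + 0
    justBelow-red = solve-∀
    level-red : ∀ k → k + + 0 - (-[1+ 0 ] + (k + + 0)) ≡ + 1
    level-red = solve-∀

  δ≡ρ-left : ∀ {x} → LeftOfSwap i p x → δ x ≡ ρ x
  δ≡ρ-left {x@(info q r _ (red v))} (q<p , refl , r≤i) with rankClass i r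
  ... | below r<i-1
    rewrite pair-< x S  (inj₁ (ℤP.<-trans r<i-1 (i-1<i i)))
          | pair-< x W  (inj₁ (ℤP.<-trans r<i-1 i-1<i+k))
          | pair-< x W′ (inj₁ (ℤP.<-trans r<i-1 (i-1<i i)))
          | pair-< x S′ (inj₁ r<i-1)
          | ⌊⌋-true (q ℕ.<? p) q<p
          | ⌊⌋-false (r ℤ.≟ i - + 1) (ℤP.<⇒≢ r<i-1)
          | ⌊⌋-false (r ℤ.≟ i) (ℤP.<⇒≢ (ℤP.<-trans r<i-1 (i-1<i i)))
    = cancel (+ v)
  ... | justBelow
    rewrite pair-< x S  (inj₁ (i-1<i i))
          | pair-< x W  (inj₁ i-1<i+k)
          | pair-< x W′ (inj₁ (i-1<i i))
          | pair-> x S′ (inj₂ (refl , ℕP.m<n⇒m<1+n q<p))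
          | ⌊⌋-true (q ℕ.<? p) q<p
          | ⌊⌋-true (i - + 1 ℤ.≟ i - + 1) refl
          | ⌊⌋-false (i - + 1 ℤ.≟ i) (ℤP.<⇒≢ (i-1<i i))
    = justBelow-red (+ v) (+ k)
  ... | level
    rewrite pair-> x S  (inj₂ (refl , q<p))
          | pair-< x W  (inj₁ i<i+k)
          | pair-> x W′ (inj₂ (refl , q<p))
          | pair-> x S′ (inj₁ (i-1<i i))
          | ⌊⌋-true (q ℕ.<? p) q<p
          | ⌊⌋-false (i ℤ.≟ i - + 1) (ℤP.<⇒≢ (i-1<i i) ∘ sym)
          | ⌊⌋-true (i ℤ.≟ i) refl
    = level-red (+ k)
  ... | above i<r = ⊥-elim (ℤP.<⇒≱ i<r (r≤i tt))
  δ≡ρ-left {x@(info q r _ blue)} (q<p , _) with rankClass i r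
  ... | below r<i-1
    rewrite pair-< x S  (inj₁ (ℤP.<-trans r<i-1 (i-1<i i)))
          | pair-< x S′ (inj₁ r<i-1)
          | ⌊⌋-true (q ℕ.<? p) q<p
          | ⌊⌋-false (r ℤ.≟ i - + 1) (ℤP.<⇒≢ r<i-1)
          | ⌊⌋-false (p ℕ.<? q) (ℕP.<-asym q<p)
    = refl
  ... | justBelow
    rewrite pair-< x S  (inj₁ (i-1<i i))
          | pair-> x S′ (inj₂ (refl , ℕP.m<n⇒m<1+n q<p))
          | ⌊⌋-true (q ℕ.<? p) q<p
          | ⌊⌋-true (i - + 1 ℤ.≟ i - + 1) refl
          | ⌊⌋-false (p ℕ.<? q) (ℕP.<-asym q<p)
    = refl
  ... | level
    rewrite pair-> x S  (inj₂ (refl , q<p))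
          | pair-> x S′ (inj₁ (i-1<i i))
          | ⌊⌋-true (q ℕ.<? p) q<p
          | ⌊⌋-false (i ℤ.≟ i - + 1) (ℤP.<⇒≢ (i-1<i i) ∘ sym)
          | ⌊⌋-false (p ℕ.<? q) (ℕP.<-asym q<p)
    = refl
  ... | above i<r
    rewrite pair-> x S  (inj₁ i<r)
          | pair-> x S′ (inj₁ (ℤP.<-trans (i-1<i i) i<r))
          | ⌊⌋-true (q ℕ.<? p) q<p
          | ⌊⌋-false (r ℤ.≟ i - + 1) (ℤP.<⇒≢ (ℤP.<-trans (i-1<i i) i<r) ∘ sym)
          | ⌊⌋-false (p ℕ.<? q) (ℕP.<-asym q<p)
    = refl

  δ≡ρ-right : ∀ {x} → RightOfSwap i p x → δ x ≡ ρ x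
  δ≡ρ-right {x@(info q r _ (red v))} (p+1<q , r<i) with rankClass i r
  ... | below r<i-1
    rewrite pair-< x S  (inj₁ (ℤP.<-trans r<i-1 (i-1<i i)))
          | pair-< x W  (inj₁ (ℤP.<-trans r<i-1 i-1<i+k))
          | pair-< x W′ (inj₁ (ℤP.<-trans r<i-1 (i-1<i i)))
          | pair-< x S′ (inj₁ r<i-1)
          | ⌊⌋-false (q ℕ.<? p) (ℕP.<-asym (ℕP.<⇒≤ p+1<q))
    = cancel (+ v)
  ... | justBelow
    rewrite pair-< x S  (inj₁ (i-1<i i))
          | pair-< x W  (inj₁ i-1<i+k)
          | pair-< x W′ (inj₁ (i-1<i i))
          | pair-< x S′ (inj₂ (refl , p+1<q))
          | ⌊⌋-false (q ℕ.<? p) (ℕP.<-asym (ℕP.<⇒≤ p+1<q))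
    = cancel (+ v)
  ... | level     = ⊥-elim (ℤP.<-irrefl refl (r<i tt))
  ... | above i<r = ⊥-elim (ℤP.<-asym i<r (r<i tt))
  δ≡ρ-right {x@(info q r _ blue)} (p+1<q , _) with rankClass i r
  ... | below r<i-1
    rewrite pair-< x S  (inj₁ (ℤP.<-trans r<i-1 (i-1<i i)))
          | pair-< x S′ (inj₁ r<i-1)
          | ⌊⌋-false (q ℕ.<? p) (ℕP.<-asym (ℕP.<⇒≤ p+1<q))
          | ⌊⌋-true (p ℕ.<? q) (ℕP.<⇒≤ p+1<q)
          | ⌊⌋-false (r ℤ.≟ i) (ℤP.<⇒≢ (ℤP.<-trans r<i-1 (i-1<i i)))
    = refl
  ... | justBelow
    rewrite pair-< x S  (inj₁ (i-1<i i))
          | pair-< x S′ (inj₂ (refl , p+1<q))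
          | ⌊⌋-false (q ℕ.<? p) (ℕP.<-asym (ℕP.<⇒≤ p+1<q))
          | ⌊⌋-true (p ℕ.<? q) (ℕP.<⇒≤ p+1<q)
          | ⌊⌋-false (i - + 1 ℤ.≟ i) (ℤP.<⇒≢ (i-1<i i))
    = refl
  ... | level
    rewrite pair-< x S  (inj₂ (refl , ℕP.<⇒≤ p+1<q))
          | pair-> x S′ (inj₁ (i-1<i i))
          | ⌊⌋-false (q ℕ.<? p) (ℕP.<-asym (ℕP.<⇒≤ p+1<q))
          | ⌊⌋-true (p ℕ.<? q) (ℕP.<⇒≤ p+1<q)
          | ⌊⌋-true (i ℤ.≟ i) refl
    = refl
  ... | above i<r
    rewrite pair-> x S  (inj₁ i<r)
          | pair-> x S′ (inj₁ (ℤP.<-trans (i-1<i i) i<r))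
          | ⌊⌋-false (q ℕ.<? p) (ℕP.<-asym (ℕP.<⇒≤ p+1<q))
          | ⌊⌋-true (p ℕ.<? q) (ℕP.<⇒≤ p+1<q)
          | ⌊⌋-false (r ℤ.≟ i) (ℤP.<⇒≢ i<r ∘ sym)
    = refl

  sweepArea-SW : sweepArea (S ∷ W ∷ []) ≡ + 0
  sweepArea-SW rewrite pair-< S W (inj₁ i<i+k) = refl

  sweepArea-W′S′ : sweepArea (W′ ∷ S′ ∷ []) ≡ + 0
  sweepArea-W′S′ rewrite pair-> W′ S′ (inj₁ (i-1<i i)) = refl

  ∑ρ-drop-SW : ∀ C → ∑ ρ (S ∷ W ∷ C) ≡ ∑ ρ C
  ∑ρ-drop-SW C
    rewrite ⌊⌋-false (p ℕ.<? p) (ℕP.<-irrefl refl)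
          | ⌊⌋-false (suc p ℕ.<? p) (ℕP.<-asym (ℕP.n<1+n p))
          | ⌊⌋-true (p ℕ.<? suc p) (ℕP.n<1+n p)
          | ⌊⌋-false (i + + k ℤ.≟ i) (ℤP.<⇒≢ i<i+k ∘ sym)
    = trans (ℤP.+-identityˡ _) (ℤP.+-identityˡ _)

  sweepArea-swap : ∀ A C → All (LeftOfSwap i p) A → All (RightOfSwap i p) C →
    sweepArea (A ++ S ∷ W ∷ C) - sweepArea (A ++ W′ ∷ S′ ∷ C) ≡ ∑ ρ (A ++ S ∷ W ∷ C)
  sweepArea-swap A C left right = begin
    sweepArea (A ++ S ∷ W ∷ C) - sweepArea (A ++ W′ ∷ S′ ∷ C)
      ≡⟨ sweepArea-replace A (S ∷ W ∷ []) (W′ ∷ S′ ∷ []) C ⟩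
    sweepArea (S ∷ W ∷ []) - sweepArea (W′ ∷ S′ ∷ []) + (∑ δ A + ∑ δ C)
      ≡⟨ cong₂ _+_ (cong₂ _-_ sweepArea-SW sweepArea-W′S′) (cong₂ _+_ (∑-cong δ≡ρ-left left) (∑-cong δ≡ρ-right right)) ⟩
    + 0 + (∑ ρ A + ∑ ρ C)
      ≡⟨ ℤP.+-identityˡ _ ⟩
    ∑ ρ A + ∑ ρ C
      ≡⟨ cong (_+_ (∑ ρ A)) (sym (∑ρ-drop-SW C)) ⟩
    ∑ ρ A + ∑ ρ (S ∷ W ∷ C)
      ≡⟨ sym (∑-++ ρ A (S ∷ W ∷ C)) ⟩
    ∑ ρ (A ++ S ∷ W ∷ C) ∎
    where open ≡-Reasoning

  ∑ρ-expand : ∀ X → ∑ ρ X ≡ ∑ lenSL₋ X - ∑ (χ ∘ inSL₋) X * + k + ∑ (χ ∘ inSL) X - ∑ (χ ∘ inB₁) X - ∑ (χ ∘ inB₂) X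
  ∑ρ-expand []      = refl
  ∑ρ-expand (x ∷ X) = trans (cong (_+_ (ρ x)) (∑ρ-expand X))
    (solve (lenSL₋ x) (χ (inSL₋ x)) (χ (inSL x)) (χ (inB₁ x)) (χ (inB₂ x))
           (∑ lenSL₋ X) (∑ (χ ∘ inSL₋) X) (∑ (χ ∘ inSL) X) (∑ (χ ∘ inB₁) X) (∑ (χ ∘ inB₂) X) (+ k))
    where
    solve : ∀ f a b c d F A B C D k →
      f - a * k + b - c - d + (F - A * k + B - C - D) ≡ (f + F) - (a + A) * k + (b + B) - (c + C) - (d + D)
    solve = solve-∀

  counts≡∑ρ : ∀ X →
    ∑ len (filterᵇ inSL₋ X) - + k * + length (filterᵇ inSL₋ X) + + length (filterᵇ inSL X)
      - + length (filterᵇ inB₁ X) - + length (filterᵇ inB₂ X) ≡ ∑ ρ X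
  counts≡∑ρ X = trans
    (combine (∑-filterᵇ len inSL₋ X) (length-filterᵇ inSL₋ X) (length-filterᵇ inSL X)
             (length-filterᵇ inB₁ X) (length-filterᵇ inB₂ X))
    (sym (∑ρ-expand X))
    where
    combine : ∀ {a a′ b b′ c c′ d d′ e e′ : ℤ} → a ≡ a′ → b ≡ b′ → c ≡ c′ → d ≡ d′ → e ≡ e′ →
              a - + k * b + c - d - e ≡ a′ - b′ * + k + c′ - d′ - e′
    combine {a} {b = b} {c = c} {d = d} {e = e} refl refl refl refl refl =
      cong (λ t → a - t + c - d - e) (ℤP.*-comm (+ k) b)

positive-red : ∀ L k R → All (0 ℕ.<_) (redVals (L ++ red k ∷ R)) → 0 ℕ.< k
positive-red []          k R (k>0 ∷ _) = k>0
positive-red (red _ ∷ L) k R (_ ∷ pos) = positive-red L k R pos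
positive-red (blue ∷ L)  k R pos       = positive-red L k R pos

proposition3p4 : (ks : List ℕ) (L : List Arrow) (k : ℕ) (R : List Arrow) →
    let Dbar  = L ++ red k ∷ blue ∷ R
        Dbar' = L ++ blue ∷ red k ∷ R
        p     = length L
        i     = sumℤ (map val L)
    in InDK ks Dbar →
       + 0 < area Dbar →
       All (λ x → T (isRed (arr x)) → (rk x ≤ i) × (rk x ≡ i → pos x Data.Nat.≤ p)) (infos Dbar) →
       area (Φ Dbar) - area (Φ Dbar')
         ≡ sumℤ (map len (SL (i - + 1) p Dbar))
           - + k * + length (SL (i - + 1) p Dbar)
           + + length (SL i p Dbar)
           - + cbLeft (i - + 1) p Dbar
           - + cbRight i p Dbar
proposition3p4 ks L zero R inDK _ _ =
  ⊥-elim (ℕP.<-irrefl refl (positive-red L zero (blue ∷ R)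
    (All-resp-↭ (↭-sym (InDK.reds-perm inDK)) (InDK.ks-pos inDK))))
proposition3p4 ks L (suc k₀) R _ _ maximal
  with infos-split L (red (suc k₀)) blue R | infos-split L blue (red (suc k₀)) R
... | ℓS , ℓW , split | ℓW′ , ℓS′ , split′ = begin
  area (Φ Dbar) - area (Φ Dbar′)
    ≡⟨ cong₂ _-_ (area-Φ Dbar) (area-Φ Dbar′) ⟩
  sweepArea (infos Dbar) - sweepArea (infos Dbar′)
    ≡⟨ cong₂ (λ X X′ → sweepArea X - sweepArea X′) split
             (trans split′ (cong (λ r → A ++ W′ ∷ S′ ∷ annot r (suc (suc p)) R) (+-swapʳ i -[1+ 0 ] (+ k)))) ⟩
  sweepArea (A ++ S ∷ W ∷ C) - sweepArea (A ++ W′ ∷ S′ ∷ C)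
    ≡⟨ sweepArea-swap A C (prefixInfos-leftOfSwap L (proj₁ maximalA,SWC))
                          (annot-rightOfSwap _ R (All.tail (All.tail (proj₂ maximalA,SWC)))) ⟩
  ∑ ρ (A ++ S ∷ W ∷ C)
    ≡⟨ cong (∑ ρ) (sym split) ⟩
  ∑ ρ (infos Dbar)
    ≡⟨ sym (counts≡∑ρ (infos Dbar)) ⟩
  _ ∎
  where
  open ≡-Reasoning
  p = length L
  i = sumℤ (map val L)
  Dbar  = L ++ red (suc k₀) ∷ blue ∷ R
  Dbar′ = L ++ blue ∷ red (suc k₀) ∷ R
  open Swap i p k₀ ℓS ℓW ℓW′ ℓS′
  A = prefixInfos (+ 0) 0 L
  C = annot (i + + k + -[1+ 0 ]) (suc (suc p)) R
  maximalA,SWC = ++⁻ A (subst (All (RedMaximal i p)) split maximal)
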